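{- Let $d_1,\dots,d_n$ be positive integers. Then the group of Clifford units $\mathcal{O}^\times$ of any order $\mathcal{O}$ in $\left(\frac{ -d_1,\dots,-d_n}{\mathbb{Q}}\right)$ is finite.
   Context: $\left(\frac{ -d_1,\dots,-d_n}{\mathbb{Q}}\right)$ is the $\mathbb{Q}$-algebra generated by $\gamma_1,\dots,\gamma_n$ with $\gamma_j^2=-d_j$ and $\gamma_j\gamma_k=-\gamma_k\gamma_j$ ($j\ne k$). Involutions: parity $x'$ ($\gamma_j\mapsto-\gamma_j$), transpose $x^*$ (anti-automorphism fixing $\gamma_j$), $\bar x=(x')^*$. Clifford vectors: $\mathbb{Q}+\sum\mathbb{Q}\gamma_j$. Clifford group: invertible elements $x$ with $x\bar x\in\mathbb{Q}$ and $x\operatorname{Vec}x^*\subseteq\operatorname{Vec}$. An order is a subring that is a finitely generated $\mathbb{Z}$-module spanning the algebra. $\mathcal{O}^\times$ is the set of units of $\mathcal{O}$ (with inverse in $\mathcal{O}$) lying in the Clifford group. -}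

module Defs where

open import Data.Nat as ℕ using (ℕ; zero; suc)
open import Data.Integer as ℤ using (ℤ; +_)
open import Data.Rational as ℚ using (ℚ; 0ℚ; 1ℚ; _/_)
open import Data.Bool using (Bool; true; false; _xor_; _∧_; not; if_then_else_)
open import Data.Vec using (Vec; []; _∷_)
open import Data.List as L using (List; []; _∷_)
open import Data.List.Relation.Unary.Any using (Any)
open import Data.Product using (Σ; _×_; _,_; ∃; proj₂)
open import Data.List.Relation.Unary.All using (All)
open import Relation.Binary.PropositionalEquality using (_≡_)

-- The algebra (-d_1,...,-d_n / ℚ), n generators γ_0..γ_{n-1}.
-- Basis: monomials e_S = γ_{i1} γ_{i2} ... γ_{ik} (i1 < ... < ik),
-- indexed by S : Vec Bool n (S[j] = true iff γ_j occurs).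
-- An element is its coefficient function (Vec Bool n → ℚ), with
-- pointwise equality _≈_.

Basis : ℕ → Set
Basis n = Vec Bool n

Alg : ℕ → Set
Alg n = Basis n → ℚ

_≈_ : ∀ {n} → Alg n → Alg n → Set
x ≈ y = ∀ S → x S ≡ y S

allBasis : ∀ n → List (Basis n)
allBasis zero = [] ∷ []
allBasis (suc n) = L.map (false ∷_) (allBasis n) L.++ L.map (true ∷_) (allBasis n)

size : ∀ {n} → Basis n → ℕ
size [] = 0
size (false ∷ S) = size S
size (true ∷ S) = suc (size S)

_⊕_ : ∀ {n} → Basis n → Basis n → Basis n
[] ⊕ [] = []
(a ∷ S) ⊕ (b ∷ T) = (a xor b) ∷ (S ⊕ T)

sgn : ℕ → ℚ
sgn zero = 1ℚ
sgn (suc k) = ℚ.- sgn k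

ℕtoℚ : ℕ → ℚ
ℕtoℚ k = (+ k) / 1

ℤtoℚ : ℤ → ℚ
ℤtoℚ z = z / 1

-- Structure constant: e_S e_T = mulCoef d S T · e_{S ⊕ T}.
-- Recursion: e_{a∷S} = γ_0^a e_S, and
--   γ_0^a e_S γ_0^b e_T = (-1)^{b·|S|} γ_0^a γ_0^b e_S e_T,
--   γ_0 γ_0 = -d_0.
mulCoef : ∀ {n} → Vec ℕ n → Basis n → Basis n → ℚ
mulCoef [] [] [] = 1ℚ
mulCoef (d ∷ ds) (a ∷ S) (b ∷ T) =
  ℚ._*_ (ℚ._*_ swap square) (mulCoef ds S T)
  where
  swap : ℚ
  swap = if b then sgn (size S) else 1ℚ
  square : ℚ
  square = if a ∧ b then ℚ.- ℕtoℚ d else 1ℚ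

sumList : List ℚ → ℚ
sumList = L.foldr ℚ._+_ 0ℚ

module Clifford {n : ℕ} (d : Vec ℕ n) where

  zeroA : Alg n
  zeroA _ = 0ℚ

  scalar : ℚ → Alg n
  scalar q S with size S
  ... | zero = q
  ... | suc _ = 0ℚ

  oneA : Alg n
  oneA = scalar 1ℚ

  _+A_ : Alg n → Alg n → Alg n
  (x +A y) S = ℚ._+_ (x S) (y S)

  -A_ : Alg n → Alg n
  (-A x) S = ℚ.- (x S)

  _·_ : ℚ → Alg n → Alg n
  (q · x) S = ℚ._*_ q (x S)

  _*A_ : Alg n → Alg n → Alg n
  (x *A y) U = sumList (L.map (λ S → ℚ._*_ (ℚ._*_ (x S) (y (S ⊕ U))) (mulCoef d S (S ⊕ U))) (allBasis n))

  -- parity x' : γ_j ↦ -γ_j, so e_S ↦ (-1)^{|S|} e_S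
  parity : Alg n → Alg n
  parity x S = ℚ._*_ (sgn (size S)) (x S)

  -- transpose x* : anti-automorphism fixing γ_j, so
  -- e_S = γ_{i1}…γ_{ik} ↦ γ_{ik}…γ_{i1} = (-1)^{k(k-1)/2} e_S
  revSign : ℕ → ℚ
  revSign zero = 1ℚ
  revSign (suc k) = ℚ._*_ (sgn k) (revSign k)

  transpose : Alg n → Alg n
  transpose x S = ℚ._*_ (revSign (size S)) (x S)

  conj : Alg n → Alg n
  conj x = transpose (parity x)

  IsScalar : Alg n → Set
  IsScalar x = Σ ℚ λ q → x ≈ scalar q

  IsVec : Alg n → Set
  IsVec x = ∀ S → 2 ℕ.≤ size S → x S ≡ 0ℚ

  IsInvertible : Alg n → Set
  IsInvertible x = Σ (Alg n) λ y → ((x *A y) ≈ oneA) × ((y *A x) ≈ oneA)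

  InCliffordGroup : Alg n → Set
  InCliffordGroup x =
    IsInvertible x × IsScalar (x *A conj x)
    × (∀ v → IsVec v → IsVec ((x *A v) *A transpose x))

  zComb : List (ℤ × Alg n) → Alg n
  zComb = L.foldr (λ { (z , g) acc → (ℤtoℚ z · g) +A acc }) zeroA

  qComb : List (ℚ × Alg n) → Alg n
  qComb = L.foldr (λ { (q , g) acc → (q · g) +A acc }) zeroA

  record IsOrder (O : Alg n → Set) : Set where
    field
      respects : ∀ {x y} → x ≈ y → O x → O y
      one∈ : O oneA
      +-closed : ∀ {x y} → O x → O y → O (x +A y)
      neg-closed : ∀ {x} → O x → O (-A x)
      *-closed : ∀ {x y} → O x → O y → O (x *A y)
      gens : List (Alg n)
      gens∈ : All O gens
      generated : ∀ {x} → O x →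
        Σ (List ℤ) λ cs → (L.length cs ≡ L.length gens)
          × (x ≈ zComb (L.zip cs gens))
      spans : ∀ x → Σ (List (ℚ × Alg n)) λ ps →
        All (λ p → O (proj₂ p)) ps × (x ≈ qComb ps)

  IsCliffordUnit : (O : Alg n → Set) → Alg n → Set
  IsCliffordUnit O x =
    O x × (Σ (Alg n) λ y → O y × ((x *A y) ≈ oneA) × ((y *A x) ≈ oneA))
    × InCliffordGroup x

  IsFinite : (Alg n → Set) → Set
  IsFinite P = Σ (List (Alg n)) λ xs → ∀ x → P x → Any (x ≈_) xs

module Submission where

-- Fix N with N x_S ∈ ℤ for all x ∈ O and all S (a common denominator of a ℤ-spanning set).
-- For a Clifford unit x with inverse y ∈ O and x x̄ = q ∈ ℚ, associativity gives
-- x̄ = (y x) x̄ = y (x x̄) = q y, i.e. x_S = ±q y_S coefficientwise. The constant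
-- coefficient of x y = 1 then reads 1 = q Σ_S d_S y_S², with d_S = ∏_{j ∈ S} d_j > 0.
-- Writing y_S = k_S / N this is N² = q K with K = Σ_S d_S k_S² ≥ |k_S|, so
-- |N x_S| = |k_S| N² / K ≤ N²: the coefficients of x lie in the finite set
-- {m / N : |m| ≤ N²}.

open import Defs
open import Data.Nat using (ℕ; _<_)
open import Data.Vec using (Vec)
open import Data.Vec.Relation.Unary.All using (All)
open import Data.Nat as ℕ using (zero; suc; _≤_)
open import Data.Nat.Divisibility using (_∣_; divides)
import Data.Nat.Properties as ℕP
import Data.Nat.ListAction as ℕL
import Data.Nat.ListAction.Properties as ℕLP
open import Data.Integer as ℤ using (ℤ; +_; -[1+_])
import Data.Integer.Properties as ℤP
open import Data.Rational as ℚ using (ℚ; 0ℚ; 1ℚ; _+_; _*_; -_; mkℚ)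
import Data.Rational.Properties as ℚP
open import Data.Rational.Unnormalised as ℚᵘ using (mkℚᵘ; *≡*)
import Data.Rational.Unnormalised.Properties as ℚᵘP
open import Data.Rational.Solver using (module +-*-Solver)
open import Data.Bool using (true; false)
open import Data.Vec using ([]; _∷_)
import Data.Vec.Relation.Unary.All as VAll
open import Data.List as L using (List; []; _∷_; _++_; map)
import Data.List.Properties as LP
open import Data.List.Relation.Unary.All as LAll using () renaming (All to LAll)
import Data.List.Relation.Unary.All.Properties as LAllP
open import Data.List.Relation.Unary.Any as Any using (Any; here; there)
import Data.List.Relation.Unary.Any.Properties as AnyP
open import Data.List.Membership.Propositional using (_∈_)
open import Data.List.Membership.Propositional.Properties using (∈-map⁺; ∈-++⁺ˡ; ∈-++⁺ʳ; ∈-upTo⁺; ∈-concatMap⁺)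
open import Data.Product using (Σ; _×_; _,_; proj₁; proj₂)
open import Data.Sum using (_⊎_; inj₁; inj₂)
open import Function using (_∘_)
open import Relation.Binary.PropositionalEquality
open +-*-Solver
open ≡-Reasoning

ℤtoℚ-≃ : ∀ z → ℚ.toℚᵘ (ℤtoℚ z) ℚᵘ.≃ mkℚᵘ z 0
ℤtoℚ-≃ z = ℚP.toℚᵘ-fromℚᵘ (mkℚᵘ z 0)

ℤtoℚ-+ : ∀ a b → ℤtoℚ (a ℤ.+ b) ≡ ℤtoℚ a + ℤtoℚ b
ℤtoℚ-+ a b = ℚP.toℚᵘ-injective (ℚᵘP.≃-trans (ℤtoℚ-≃ (a ℤ.+ b)) (ℚᵘP.≃-trans (*≡* ℤ-identity)
  (ℚᵘP.≃-sym (ℚᵘP.≃-trans (ℚP.toℚᵘ-homo-+ (ℤtoℚ a) (ℤtoℚ b)) (ℚᵘP.+-cong (ℤtoℚ-≃ a) (ℤtoℚ-≃ b))))))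
  where
  ℤ-identity : (a ℤ.+ b) ℤ.* + 1 ≡ (a ℤ.* + 1 ℤ.+ b ℤ.* + 1) ℤ.* + 1
  ℤ-identity = cong (ℤ._* + 1) (sym (cong₂ ℤ._+_ (ℤP.*-identityʳ a) (ℤP.*-identityʳ b)))

ℤtoℚ-* : ∀ a b → ℤtoℚ (a ℤ.* b) ≡ ℤtoℚ a * ℤtoℚ b
ℤtoℚ-* a b = ℚP.toℚᵘ-injective (ℚᵘP.≃-trans (ℤtoℚ-≃ (a ℤ.* b)) (ℚᵘP.≃-trans (*≡* refl)
  (ℚᵘP.≃-sym (ℚᵘP.≃-trans (ℚP.toℚᵘ-homo-* (ℤtoℚ a) (ℤtoℚ b)) (ℚᵘP.*-cong (ℤtoℚ-≃ a) (ℤtoℚ-≃ b))))))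

ℤtoℚ-neg : ∀ a → ℤtoℚ (ℤ.- a) ≡ - ℤtoℚ a
ℤtoℚ-neg a = ℚP.toℚᵘ-injective (ℚᵘP.≃-trans (ℤtoℚ-≃ (ℤ.- a))
  (ℚᵘP.≃-sym (ℚᵘP.≃-trans (ℚP.toℚᵘ-homo‿- (ℤtoℚ a)) (ℚᵘP.-‿cong (ℤtoℚ-≃ a)))))

ℤtoℚ-injective : ∀ {a b} → ℤtoℚ a ≡ ℤtoℚ b → a ≡ b
ℤtoℚ-injective {a} {b} e = begin
  a           ≡⟨ ℤP.*-identityʳ a ⟨
  a ℤ.* + 1   ≡⟨ ℚᵘP.drop-*≡* (ℚᵘP.≃-trans (ℚᵘP.≃-sym (ℤtoℚ-≃ a))
                   (ℚᵘP.≃-trans (ℚᵘP.≃-reflexive (cong ℚ.toℚᵘ e)) (ℤtoℚ-≃ b))) ⟩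
  b ℤ.* + 1   ≡⟨ ℤP.*-identityʳ b ⟩
  b           ∎

ℕtoℚ-* : ∀ a b → ℕtoℚ (a ℕ.* b) ≡ ℕtoℚ a * ℕtoℚ b
ℕtoℚ-* a b = trans (cong ℤtoℚ (ℤP.pos-* a b)) (ℤtoℚ-* (+ a) (+ b))

ℕtoℚ-injective : ∀ {a b} → ℕtoℚ a ≡ ℕtoℚ b → a ≡ b
ℕtoℚ-injective {a} {b} e = cong ℤ.∣_∣ (ℤtoℚ-injective {+ a} {+ b} e)

ℤtoℚ-square : ∀ k → ℤtoℚ k * ℤtoℚ k ≡ ℕtoℚ (ℤ.∣ k ∣ ℕ.* ℤ.∣ k ∣)
ℤtoℚ-square (+ a) = sym (ℕtoℚ-* a a)
ℤtoℚ-square -[1+ a ] = sym (ℤtoℚ-* -[1+ a ] -[1+ a ])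

ℕtoℚ-nonZero : ∀ N .{{_ : ℕ.NonZero N}} → ℚ.NonZero (ℕtoℚ N)
ℕtoℚ-nonZero N = ℚ.≢-nonZero λ N≡0 → ℕ.≢-nonZero⁻¹ N (ℕtoℚ-injective {N} {0} N≡0)

*≡⇒≡*1/ : ∀ p r s .{{_ : ℚ.NonZero r}} → p * r ≡ s → p ≡ s * ℚ.1/ r
*≡⇒≡*1/ p r s refl = begin
  p                     ≡⟨ ℚP.*-identityʳ p ⟨
  p * 1ℚ                ≡⟨ cong (p *_) (ℚP.*-inverseʳ r) ⟨
  p * (r * ℚ.1/ r)      ≡⟨ ℚP.*-assoc p r (ℚ.1/ r) ⟨
  p * r * ℚ.1/ r        ∎

Integral : ℚ → Set
Integral q = Σ ℤ λ z → q ≡ ℤtoℚ z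

integral-+ : ∀ {p q} → Integral p → Integral q → Integral (p + q)
integral-+ (a , refl) (b , refl) = a ℤ.+ b , sym (ℤtoℚ-+ a b)

integral-* : ∀ {p q} → Integral p → Integral q → Integral (p * q)
integral-* (a , refl) (b , refl) = a ℤ.* b , sym (ℤtoℚ-* a b)

integral-ℤtoℚ : ∀ z → Integral (ℤtoℚ z)
integral-ℤtoℚ z = z , refl

integral-resp : ∀ {p q} → p ≡ q → Integral p → Integral q
integral-resp refl i = i

*-denominator-integral : ∀ q → Integral (q * ℕtoℚ (ℚ.↧ₙ q))
*-denominator-integral q@(mkℚ n d-1 _) = n , ℚP.toℚᵘ-injective (ℚᵘP.≃-trans (ℚP.toℚᵘ-homo-* q (ℕtoℚ (suc d-1)))
  (ℚᵘP.≃-trans (ℚᵘP.*-congˡ {mkℚᵘ n d-1} (ℤtoℚ-≃ (+ suc d-1))) (ℚᵘP.≃-trans (*≡* cancel) (ℚᵘP.≃-sym (ℤtoℚ-≃ n)))))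
  where
  cancel : n ℤ.* + suc d-1 ℤ.* + 1 ≡ n ℤ.* + suc (d-1 ℕ.* 1)
  cancel = trans (ℤP.*-identityʳ _) (cong (λ k → n ℤ.* + suc k) (sym (ℕP.*-identityʳ d-1)))

*-multiple-integral : ∀ {q a b} → Integral (q * ℕtoℚ a) → a ∣ b → Integral (q * ℕtoℚ b)
*-multiple-integral {q} {a} i (divides c refl) = integral-resp
  (trans (ℚP.*-assoc q (ℕtoℚ a) (ℕtoℚ c)) (cong (q *_) (trans (ℚP.*-comm (ℕtoℚ a) (ℕtoℚ c)) (sym (ℕtoℚ-* c a)))))
  (integral-* i (integral-ℤtoℚ (+ c)))

sumList-++ : ∀ xs ys → sumList (xs ++ ys) ≡ sumList xs + sumList ys
sumList-++ [] ys = sym (ℚP.+-identityˡ _)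
sumList-++ (x ∷ xs) ys = trans (cong (_+_ x) (sumList-++ xs ys)) (sym (ℚP.+-assoc x _ _))

sumList-*ˡ : ∀ {A : Set} k (f : A → ℚ) xs → sumList (map (λ a → k * f a) xs) ≡ k * sumList (map f xs)
sumList-*ˡ k f [] = sym (ℚP.*-zeroʳ k)
sumList-*ˡ k f (x ∷ xs) = trans (cong (_+_ (k * f x)) (sumList-*ˡ k f xs)) (sym (ℚP.*-distribˡ-+ k _ _))

sumList-allBasis : ∀ {n} (f : Basis (suc n) → ℚ) →
  sumList (map f (allBasis (suc n)))
    ≡ sumList (map (f ∘ (false ∷_)) (allBasis n)) + sumList (map (f ∘ (true ∷_)) (allBasis n))
sumList-allBasis {n} f = begin
  sumList (map f (map (false ∷_) B ++ map (true ∷_) B))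
    ≡⟨ cong sumList (LP.map-++ f (map (false ∷_) B) _) ⟩
  sumList (map f (map (false ∷_) B) ++ map f (map (true ∷_) B))
    ≡⟨ sumList-++ (map f (map (false ∷_) B)) _ ⟩
  sumList (map f (map (false ∷_) B)) + sumList (map f (map (true ∷_) B))
    ≡⟨ cong₂ _+_ (cong sumList (LP.map-∘ B)) (cong sumList (LP.map-∘ B)) ⟨
  sumList (map (f ∘ (false ∷_)) B) + sumList (map (f ∘ (true ∷_)) B) ∎
  where
  B : List (Basis n)
  B = allBasis n

ℕtoℚ-sum : ∀ {A : Set} (f : A → ℕ) xs → ℕtoℚ (ℕL.sum (map f xs)) ≡ sumList (map (ℕtoℚ ∘ f) xs)
ℕtoℚ-sum f [] = refl
ℕtoℚ-sum f (a ∷ xs) = begin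
  ℤtoℚ (+ (f a ℕ.+ ℕL.sum (map f xs)))           ≡⟨ cong ℤtoℚ (ℤP.pos-+ (f a) _) ⟩
  ℤtoℚ (+ f a ℤ.+ + ℕL.sum (map f xs))           ≡⟨ ℤtoℚ-+ (+ f a) (+ ℕL.sum (map f xs)) ⟩
  ℕtoℚ (f a) + ℕtoℚ (ℕL.sum (map f xs))          ≡⟨ cong (_+_ (ℕtoℚ (f a))) (ℕtoℚ-sum f xs) ⟩
  ℕtoℚ (f a) + sumList (map (ℕtoℚ ∘ f) xs)       ∎

∈⇒≤sum : ∀ {m ms} → m ∈ ms → m ≤ ℕL.sum ms
∈⇒≤sum (here refl) = ℕP.m≤m+n _ _
∈⇒≤sum {ms = m ∷ _} (there p) = ℕP.≤-trans (∈⇒≤sum p) (ℕP.m≤n+m _ m)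

m≤m*m*n : ∀ m n .{{_ : ℕ.NonZero n}} → m ≤ m ℕ.* m ℕ.* n
m≤m*m*n zero n = ℕ.z≤n
m≤m*m*n m@(suc _) n = ℕP.≤-trans (ℕP.m≤m*n m m) (ℕP.m≤m*n (m ℕ.* m) n)

∈-allBasis : ∀ {n} (S : Basis n) → S ∈ allBasis n
∈-allBasis [] = here refl
∈-allBasis {suc n} (false ∷ S) = ∈-++⁺ˡ (∈-map⁺ (false ∷_) (∈-allBasis S))
∈-allBasis {suc n} (true ∷ S) = ∈-++⁺ʳ (map (false ∷_) (allBasis n)) (∈-map⁺ (true ∷_) (∈-allBasis S))

IsSign : ℚ → Set
IsSign s = s ≡ 1ℚ ⊎ s ≡ - 1ℚ

sign-* : ∀ {s t} → IsSign s → IsSign t → IsSign (s * t)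
sign-* (inj₁ refl) (inj₁ refl) = inj₁ refl
sign-* (inj₁ refl) (inj₂ refl) = inj₂ refl
sign-* (inj₂ refl) (inj₁ refl) = inj₂ refl
sign-* (inj₂ refl) (inj₂ refl) = inj₁ refl

sign-square : ∀ {s} → IsSign s → s * s ≡ 1ℚ
sign-square (inj₁ refl) = refl
sign-square (inj₂ refl) = refl

sgn-isSign : ∀ k → IsSign (sgn k)
sgn-isSign zero = inj₁ refl
sgn-isSign (suc k) with sgn-isSign k
... | inj₁ e = inj₂ (cong -_ e)
... | inj₂ e = inj₁ (cong -_ e)

sgn-square : ∀ k → sgn k * sgn k ≡ 1ℚ
sgn-square k = sign-square (sgn-isSign k)

ℤtoℚ-sign⇒∣≡∣ : ∀ {s} a b → IsSign s → ℤtoℚ a ≡ s * ℤtoℚ b → ℤ.∣ a ∣ ≡ ℤ.∣ b ∣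
ℤtoℚ-sign⇒∣≡∣ a b (inj₁ refl) e = cong ℤ.∣_∣ (ℤtoℚ-injective {a} {b} (trans e (ℚP.*-identityˡ (ℤtoℚ b))))
ℤtoℚ-sign⇒∣≡∣ a b (inj₂ refl) e =
  trans (cong ℤ.∣_∣ (ℤtoℚ-injective {a} {ℤ.- b} (trans e (trans (sym (ℚP.neg-distribˡ-* 1ℚ (ℤtoℚ b)))
    (trans (cong -_ (ℚP.*-identityˡ (ℤtoℚ b))) (sym (ℤtoℚ-neg b)))))))
    (ℤP.∣-i∣≡∣i∣ b)

-- The product, computed one generator at a time

-- Copies of Clifford._+A_, Clifford._·_ and Clifford.parity free of the parameter d,
-- so that the recursion on d below can use them.
infixl 6 _⊞_
infixr 7 _⊙_

_⊞_ : ∀ {n} → Alg n → Alg n → Alg n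
(x ⊞ y) S = x S + y S

_⊙_ : ∀ {n} → ℚ → Alg n → Alg n
(k ⊙ x) S = k * x S

0ᴬ : ∀ {n} → Alg n
0ᴬ _ = 0ℚ

par : ∀ {n} → Alg n → Alg n
par x S = sgn (size S) * x S

-- x = lo x + γ₀ · hi x, where lo x and hi x lie in the subalgebra generated by the later generators.
lo : ∀ {n} → Alg (suc n) → Alg n
lo x S = x (false ∷ S)

hi : ∀ {n} → Alg (suc n) → Alg n
hi x S = x (true ∷ S)

-- Since a γ₀ = γ₀ a' and γ₀² = -d₀:  (a + γ₀ b)(c + γ₀ e) = (a c - d₀ b' e) + γ₀ (a' e + b c).
mul : ∀ {n} → Vec ℕ n → Alg n → Alg n → Alg n
mul [] x y [] = x [] * y []
mul (d ∷ ds) x y (false ∷ U) = mul ds (lo x) (lo y) U + - ℕtoℚ d * mul ds (par (hi x)) (hi y) U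
mul (d ∷ ds) x y (true ∷ U) = mul ds (par (lo x)) (hi y) U + mul ds (hi x) (lo y) U

*A≈mul : ∀ {n} (ds : Vec ℕ n) x y → Clifford._*A_ ds x y ≈ mul ds x y
*A≈mul [] x y [] = solve 2 (λ a b → a :* b :* con 1ℚ :+ con 0ℚ := a :* b) refl (x []) (y [])
*A≈mul {suc n} (d ∷ ds) x y (false ∷ U) = begin
  sumList (map F (allBasis (suc n)))
    ≡⟨ sumList-allBasis F ⟩
  sumList (map (F ∘ (false ∷_)) B) + sumList (map (F ∘ (true ∷_)) B)
    ≡⟨ cong₂ _+_ (cong sumList (LP.map-cong lo-term B))
                 (trans (cong sumList (LP.map-cong hi-term B)) (sumList-*ˡ (- ℕtoℚ d) _ B)) ⟩
  Clifford._*A_ ds (lo x) (lo y) U + - ℕtoℚ d * Clifford._*A_ ds (par (hi x)) (hi y) U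
    ≡⟨ cong₂ (λ a b → a + - ℕtoℚ d * b) (*A≈mul ds (lo x) (lo y) U) (*A≈mul ds (par (hi x)) (hi y) U) ⟩
  mul (d ∷ ds) x y (false ∷ U) ∎
  where
  B : List (Basis n)
  B = allBasis n
  F : Basis (suc n) → ℚ
  F S = x S * y (S ⊕ (false ∷ U)) * mulCoef (d ∷ ds) S (S ⊕ (false ∷ U))
  lo-term : ∀ S → F (false ∷ S) ≡ lo x S * lo y (S ⊕ U) * mulCoef ds S (S ⊕ U)
  lo-term S = solve 3 (λ a b c → a :* b :* (con 1ℚ :* con 1ℚ :* c) := a :* b :* c) refl
    (x (false ∷ S)) (y (false ∷ (S ⊕ U))) (mulCoef ds S (S ⊕ U))
  hi-term : ∀ S → F (true ∷ S) ≡ - ℕtoℚ d * (par (hi x) S * hi y (S ⊕ U) * mulCoef ds S (S ⊕ U))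
  hi-term S = solve 5 (λ a b c s k → a :* b :* (s :* k :* c) := k :* (s :* a :* b :* c)) refl
    (x (true ∷ S)) (y (true ∷ (S ⊕ U))) (mulCoef ds S (S ⊕ U)) (sgn (size S)) (- ℕtoℚ d)
*A≈mul {suc n} (d ∷ ds) x y (true ∷ U) = begin
  sumList (map F (allBasis (suc n)))
    ≡⟨ sumList-allBasis F ⟩
  sumList (map (F ∘ (false ∷_)) B) + sumList (map (F ∘ (true ∷_)) B)
    ≡⟨ cong₂ _+_ (cong sumList (LP.map-cong lo-term B)) (cong sumList (LP.map-cong hi-term B)) ⟩
  Clifford._*A_ ds (par (lo x)) (hi y) U + Clifford._*A_ ds (hi x) (lo y) U
    ≡⟨ cong₂ _+_ (*A≈mul ds (par (lo x)) (hi y) U) (*A≈mul ds (hi x) (lo y) U) ⟩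
  mul (d ∷ ds) x y (true ∷ U) ∎
  where
  B : List (Basis n)
  B = allBasis n
  F : Basis (suc n) → ℚ
  F S = x S * y (S ⊕ (true ∷ U)) * mulCoef (d ∷ ds) S (S ⊕ (true ∷ U))
  lo-term : ∀ S → F (false ∷ S) ≡ par (lo x) S * hi y (S ⊕ U) * mulCoef ds S (S ⊕ U)
  lo-term S = solve 4 (λ a b c s → a :* b :* (s :* con 1ℚ :* c) := s :* a :* b :* c) refl
    (x (false ∷ S)) (y (true ∷ (S ⊕ U))) (mulCoef ds S (S ⊕ U)) (sgn (size S))
  hi-term : ∀ S → F (true ∷ S) ≡ hi x S * lo y (S ⊕ U) * mulCoef ds S (S ⊕ U)
  hi-term S = solve 3 (λ a b c → a :* b :* (con 1ℚ :* con 1ℚ :* c) := a :* b :* c) refl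
    (x (true ∷ S)) (y (false ∷ (S ⊕ U))) (mulCoef ds S (S ⊕ U))

par-cong : ∀ {n} {x x' : Alg n} → x ≈ x' → par x ≈ par x'
par-cong e S = cong (sgn (size S) *_) (e S)

par-involutive : ∀ {n} (x : Alg n) → par (par x) ≈ x
par-involutive x S = begin
  sgn (size S) * (sgn (size S) * x S) ≡⟨ sym (ℚP.*-assoc (sgn (size S)) _ _) ⟩
  sgn (size S) * sgn (size S) * x S ≡⟨ cong (_* x S) (sgn-square (size S)) ⟩
  1ℚ * x S ≡⟨ ℚP.*-identityˡ _ ⟩
  x S ∎

par-distrib-⊞ : ∀ {n} (x y : Alg n) → par (x ⊞ y) ≈ (par x ⊞ par y)
par-distrib-⊞ x y S = ℚP.*-distribˡ-+ (sgn (size S)) (x S) (y S)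

par-⊙ : ∀ {n} k (x : Alg n) → par (k ⊙ x) ≈ (k ⊙ par x)
par-⊙ k x S = solve 3 (λ s k a → s :* (k :* a) := k :* (s :* a)) refl (sgn (size S)) k (x S)

hi-par : ∀ {n} (x : Alg (suc n)) → hi (par x) ≈ ((- 1ℚ) ⊙ par (hi x))
hi-par x S = solve 2 (λ s a → (:- s) :* a := con (- 1ℚ) :* (s :* a)) refl (sgn (size S)) (x (true ∷ S))

mul-cong : ∀ {n} (ds : Vec ℕ n) {x x' y y' : Alg n} → x ≈ x' → y ≈ y' → mul ds x y ≈ mul ds x' y'
mul-cong [] ex ey [] = cong₂ _*_ (ex []) (ey [])
mul-cong (d ∷ ds) ex ey (false ∷ U) =
  cong₂ (λ a b → a + - ℕtoℚ d * b) (mul-cong ds (λ S → ex (false ∷ S)) (λ S → ey (false ∷ S)) U)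
    (mul-cong ds (par-cong (λ S → ex (true ∷ S))) (λ S → ey (true ∷ S)) U)
mul-cong (d ∷ ds) ex ey (true ∷ U) =
  cong₂ _+_ (mul-cong ds (par-cong (λ S → ex (false ∷ S))) (λ S → ey (true ∷ S)) U)
    (mul-cong ds (λ S → ex (true ∷ S)) (λ S → ey (false ∷ S)) U)

mul-congʳ : ∀ {n} (ds : Vec ℕ n) {x x' : Alg n} (y : Alg n) → x ≈ x' → mul ds x y ≈ mul ds x' y
mul-congʳ ds y e = mul-cong ds e (λ _ → refl)

mul-congˡ : ∀ {n} (ds : Vec ℕ n) (x : Alg n) {y y' : Alg n} → y ≈ y' → mul ds x y ≈ mul ds x y'
mul-congˡ ds x e = mul-cong ds (λ _ → refl) e

mul-distribʳ-⊞ : ∀ {n} (ds : Vec ℕ n) (x y z : Alg n) → mul ds (x ⊞ y) z ≈ (mul ds x z ⊞ mul ds y z)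
mul-distribʳ-⊞ [] x y z [] = ℚP.*-distribʳ-+ (z []) (x []) (y [])
mul-distribʳ-⊞ (d ∷ ds) x y z (false ∷ U) = begin
  mul ds (lo x ⊞ lo y) (lo z) U + - ℕtoℚ d * mul ds (par (hi x ⊞ hi y)) (hi z) U
    ≡⟨ cong₂ (λ a b → a + - ℕtoℚ d * b) (mul-distribʳ-⊞ ds (lo x) (lo y) (lo z) U)
         (trans (mul-congʳ ds (hi z) (par-distrib-⊞ (hi x) (hi y)) U) (mul-distribʳ-⊞ ds (par (hi x)) (par (hi y)) (hi z) U)) ⟩
  (P + Q) + - ℕtoℚ d * (R + T)
    ≡⟨ solve 5 (λ p q r t k → (p :+ q) :+ k :* (r :+ t) := (p :+ k :* r) :+ (q :+ k :* t)) refl P Q R T (- ℕtoℚ d) ⟩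
  (P + - ℕtoℚ d * R) + (Q + - ℕtoℚ d * T) ∎
  where
  P Q R T : ℚ
  P = mul ds (lo x) (lo z) U
  Q = mul ds (lo y) (lo z) U
  R = mul ds (par (hi x)) (hi z) U
  T = mul ds (par (hi y)) (hi z) U
mul-distribʳ-⊞ (d ∷ ds) x y z (true ∷ U) = begin
  mul ds (par (lo x ⊞ lo y)) (hi z) U + mul ds (hi x ⊞ hi y) (lo z) U
    ≡⟨ cong₂ _+_ (trans (mul-congʳ ds (hi z) (par-distrib-⊞ (lo x) (lo y)) U)
                        (mul-distribʳ-⊞ ds (par (lo x)) (par (lo y)) (hi z) U))
         (mul-distribʳ-⊞ ds (hi x) (hi y) (lo z) U) ⟩
  (P + Q) + (R + T)
    ≡⟨ solve 4 (λ p q r t → (p :+ q) :+ (r :+ t) := (p :+ r) :+ (q :+ t)) refl P Q R T ⟩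
  (P + R) + (Q + T) ∎
  where
  P Q R T : ℚ
  P = mul ds (par (lo x)) (hi z) U
  Q = mul ds (par (lo y)) (hi z) U
  R = mul ds (hi x) (lo z) U
  T = mul ds (hi y) (lo z) U

mul-distribˡ-⊞ : ∀ {n} (ds : Vec ℕ n) (x y z : Alg n) → mul ds x (y ⊞ z) ≈ (mul ds x y ⊞ mul ds x z)
mul-distribˡ-⊞ [] x y z [] = ℚP.*-distribˡ-+ (x []) (y []) (z [])
mul-distribˡ-⊞ (d ∷ ds) x y z (false ∷ U) = begin
  mul ds (lo x) (lo y ⊞ lo z) U + - ℕtoℚ d * mul ds (par (hi x)) (hi y ⊞ hi z) U
    ≡⟨ cong₂ (λ a b → a + - ℕtoℚ d * b) (mul-distribˡ-⊞ ds (lo x) (lo y) (lo z) U)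
         (mul-distribˡ-⊞ ds (par (hi x)) (hi y) (hi z) U) ⟩
  (P + Q) + - ℕtoℚ d * (R + T)
    ≡⟨ solve 5 (λ p q r t k → (p :+ q) :+ k :* (r :+ t) := (p :+ k :* r) :+ (q :+ k :* t)) refl P Q R T (- ℕtoℚ d) ⟩
  (P + - ℕtoℚ d * R) + (Q + - ℕtoℚ d * T) ∎
  where
  P Q R T : ℚ
  P = mul ds (lo x) (lo y) U
  Q = mul ds (lo x) (lo z) U
  R = mul ds (par (hi x)) (hi y) U
  T = mul ds (par (hi x)) (hi z) U
mul-distribˡ-⊞ (d ∷ ds) x y z (true ∷ U) = begin
  mul ds (par (lo x)) (hi y ⊞ hi z) U + mul ds (hi x) (lo y ⊞ lo z) U
    ≡⟨ cong₂ _+_ (mul-distribˡ-⊞ ds (par (lo x)) (hi y) (hi z) U) (mul-distribˡ-⊞ ds (hi x) (lo y) (lo z) U) ⟩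
  (P + Q) + (R + T)
    ≡⟨ solve 4 (λ p q r t → (p :+ q) :+ (r :+ t) := (p :+ r) :+ (q :+ t)) refl P Q R T ⟩
  (P + R) + (Q + T) ∎
  where
  P Q R T : ℚ
  P = mul ds (par (lo x)) (hi y) U
  Q = mul ds (par (lo x)) (hi z) U
  R = mul ds (hi x) (lo y) U
  T = mul ds (hi x) (lo z) U

mul-⊙ˡ : ∀ {n} (ds : Vec ℕ n) k (x y : Alg n) → mul ds (k ⊙ x) y ≈ (k ⊙ mul ds x y)
mul-⊙ˡ [] k x y [] = ℚP.*-assoc k (x []) (y [])
mul-⊙ˡ (d ∷ ds) k x y (false ∷ U) = begin
  mul ds (k ⊙ lo x) (lo y) U + - ℕtoℚ d * mul ds (par (k ⊙ hi x)) (hi y) U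
    ≡⟨ cong₂ (λ a b → a + - ℕtoℚ d * b) (mul-⊙ˡ ds k (lo x) (lo y) U)
         (trans (mul-congʳ ds (hi y) (par-⊙ k (hi x)) U) (mul-⊙ˡ ds k (par (hi x)) (hi y) U)) ⟩
  k * P + - ℕtoℚ d * (k * Q)
    ≡⟨ solve 4 (λ k p q e → k :* p :+ e :* (k :* q) := k :* (p :+ e :* q)) refl k P Q (- ℕtoℚ d) ⟩
  k * (P + - ℕtoℚ d * Q) ∎
  where
  P Q : ℚ
  P = mul ds (lo x) (lo y) U
  Q = mul ds (par (hi x)) (hi y) U
mul-⊙ˡ (d ∷ ds) k x y (true ∷ U) = begin
  mul ds (par (k ⊙ lo x)) (hi y) U + mul ds (k ⊙ hi x) (lo y) U
    ≡⟨ cong₂ _+_ (trans (mul-congʳ ds (hi y) (par-⊙ k (lo x)) U) (mul-⊙ˡ ds k (par (lo x)) (hi y) U))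
         (mul-⊙ˡ ds k (hi x) (lo y) U) ⟩
  k * P + k * Q
    ≡⟨ sym (ℚP.*-distribˡ-+ k P Q) ⟩
  k * (P + Q) ∎
  where
  P Q : ℚ
  P = mul ds (par (lo x)) (hi y) U
  Q = mul ds (hi x) (lo y) U

mul-⊙ʳ : ∀ {n} (ds : Vec ℕ n) k (x y : Alg n) → mul ds x (k ⊙ y) ≈ (k ⊙ mul ds x y)
mul-⊙ʳ [] k x y [] = solve 3 (λ k a b → a :* (k :* b) := k :* (a :* b)) refl k (x []) (y [])
mul-⊙ʳ (d ∷ ds) k x y (false ∷ U) = begin
  mul ds (lo x) (k ⊙ lo y) U + - ℕtoℚ d * mul ds (par (hi x)) (k ⊙ hi y) U
    ≡⟨ cong₂ (λ a b → a + - ℕtoℚ d * b) (mul-⊙ʳ ds k (lo x) (lo y) U) (mul-⊙ʳ ds k (par (hi x)) (hi y) U) ⟩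
  k * P + - ℕtoℚ d * (k * Q)
    ≡⟨ solve 4 (λ k p q e → k :* p :+ e :* (k :* q) := k :* (p :+ e :* q)) refl k P Q (- ℕtoℚ d) ⟩
  k * (P + - ℕtoℚ d * Q) ∎
  where
  P Q : ℚ
  P = mul ds (lo x) (lo y) U
  Q = mul ds (par (hi x)) (hi y) U
mul-⊙ʳ (d ∷ ds) k x y (true ∷ U) = begin
  mul ds (par (lo x)) (k ⊙ hi y) U + mul ds (hi x) (k ⊙ lo y) U
    ≡⟨ cong₂ _+_ (mul-⊙ʳ ds k (par (lo x)) (hi y) U) (mul-⊙ʳ ds k (hi x) (lo y) U) ⟩
  k * P + k * Q
    ≡⟨ sym (ℚP.*-distribˡ-+ k P Q) ⟩
  k * (P + Q) ∎
  where
  P Q : ℚ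
  P = mul ds (par (lo x)) (hi y) U
  Q = mul ds (hi x) (lo y) U



par-mul : ∀ {n} (ds : Vec ℕ n) (x y : Alg n) → par (mul ds x y) ≈ mul ds (par x) (par y)
par-mul [] x y [] = solve 2 (λ a b → con 1ℚ :* (a :* b) := (con 1ℚ :* a) :* (con 1ℚ :* b)) refl (x []) (y [])
par-mul (d ∷ ds) x y (false ∷ U) = begin
  s * (P + - ℕtoℚ d * Q)
    ≡⟨ solve 4 (λ s p q k → s :* (p :+ k :* q) := s :* p :+ k :* (s :* q)) refl s P Q (- ℕtoℚ d) ⟩
  s * P + - ℕtoℚ d * (s * Q)
    ≡⟨ cong₂ (λ a b → a + - ℕtoℚ d * b) (par-mul ds (lo x) (lo y) U) (par-mul ds (par (hi x)) (hi y) U) ⟩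
  mul ds (par (lo x)) (par (lo y)) U + - ℕtoℚ d * R
    ≡⟨ cong (λ b → mul ds (par (lo x)) (par (lo y)) U + - ℕtoℚ d * b) (sym par-hi-par⋆hi-par) ⟩
  mul ds (par (lo x)) (par (lo y)) U + - ℕtoℚ d * mul ds (par (hi (par x))) (hi (par y)) U ∎
  where
  s P Q R : ℚ
  s = sgn (size U)
  P = mul ds (lo x) (lo y) U
  Q = mul ds (par (hi x)) (hi y) U
  R = mul ds (par (par (hi x))) (par (hi y)) U
  par-hi-par⋆hi-par : mul ds (par (hi (par x))) (hi (par y)) U ≡ R
  par-hi-par⋆hi-par = begin
    mul ds (par (hi (par x))) (hi (par y)) U
      ≡⟨ mul-cong ds (λ S → trans (par-cong (hi-par x) S) (par-⊙ (- 1ℚ) (par (hi x)) S)) (hi-par y) U ⟩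
    mul ds ((- 1ℚ) ⊙ par (par (hi x))) ((- 1ℚ) ⊙ par (hi y)) U
      ≡⟨ mul-⊙ˡ ds (- 1ℚ) _ _ U ⟩
    (- 1ℚ) * mul ds (par (par (hi x))) ((- 1ℚ) ⊙ par (hi y)) U
      ≡⟨ cong ((- 1ℚ) *_) (mul-⊙ʳ ds (- 1ℚ) _ _ U) ⟩
    (- 1ℚ) * ((- 1ℚ) * R)
      ≡⟨ solve 1 (λ r → con (- 1ℚ) :* (con (- 1ℚ) :* r) := r) refl R ⟩
    R ∎
par-mul (d ∷ ds) x y (true ∷ U) = begin
  (- s) * (P + Q)
    ≡⟨ solve 3 (λ s p q → (:- s) :* (p :+ q) := con (- 1ℚ) :* (s :* p) :+ con (- 1ℚ) :* (s :* q)) refl s P Q ⟩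
  (- 1ℚ) * (s * P) + (- 1ℚ) * (s * Q)
    ≡⟨ cong₂ (λ a b → (- 1ℚ) * a + (- 1ℚ) * b) (par-mul ds (par (lo x)) (hi y) U) (par-mul ds (hi x) (lo y) U) ⟩
  (- 1ℚ) * mul ds (par (par (lo x))) (par (hi y)) U + (- 1ℚ) * mul ds (par (hi x)) (par (lo y)) U
    ≡⟨ cong₂ _+_ (sym (trans (mul-congˡ ds _ (hi-par y) U) (mul-⊙ʳ ds (- 1ℚ) _ _ U)))
                 (sym (trans (mul-congʳ ds _ (hi-par x) U) (mul-⊙ˡ ds (- 1ℚ) _ _ U))) ⟩
  mul ds (par (lo (par x))) (hi (par y)) U + mul ds (hi (par x)) (lo (par y)) U ∎
  where
  s P Q : ℚ
  s = sgn (size U)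
  P = mul ds (par (lo x)) (hi y) U
  Q = mul ds (hi x) (lo y) U

par-mul-par : ∀ {n} (ds : Vec ℕ n) (x y : Alg n) → par (mul ds (par x) y) ≈ mul ds x (par y)
par-mul-par ds x y S = trans (par-mul ds (par x) y S) (mul-congʳ ds (par y) (par-involutive x) S)

module MulAssocStep {n} (d : ℕ) (ds : Vec ℕ n)
  (assoc : ∀ x y z → mul ds (mul ds x y) z ≈ mul ds x (mul ds y z))
  (x y z : Alg (suc n)) (U : Basis n) where

  a b c e f g : Alg n
  a = lo x ; b = hi x ; c = lo y ; e = hi y ; f = lo z ; g = hi z

  k : ℚ
  k = - ℕtoℚ d

  lo-assoc : mul (d ∷ ds) (mul (d ∷ ds) x y) z (false ∷ U) ≡ mul (d ∷ ds) x (mul (d ∷ ds) y z) (false ∷ U)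
  lo-assoc = begin
    mul ds (mul ds a c ⊞ k ⊙ mul ds (par b) e) f U + k * mul ds (par (mul ds (par a) e ⊞ mul ds b c)) g U
      ≡⟨ cong₂ (λ u v → u + k * v) lo-xy⋆lo-z par-hi-xy⋆hi-z ⟩
    (P + k * Q) + k * (R + T)
      ≡⟨ solve 5 (λ p q r t k → (p :+ k :* q) :+ k :* (r :+ t) := (p :+ k :* r) :+ k :* (t :+ q)) refl P Q R T k ⟩
    (P + k * R) + k * (T + Q)
      ≡⟨ cong₂ (λ u v → u + k * v) (trans (mul-distribˡ-⊞ ds a _ _ U) (cong (_+_ P) (mul-⊙ʳ ds k a _ U)))
                                   (mul-distribˡ-⊞ ds (par b) _ _ U) ⟨
    mul ds a (mul ds c f ⊞ k ⊙ mul ds (par e) g) U + k * mul ds (par b) (mul ds (par c) g ⊞ mul ds e f) U ∎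
    where
    P Q R T : ℚ
    P = mul ds a (mul ds c f) U
    Q = mul ds (par b) (mul ds e f) U
    R = mul ds a (mul ds (par e) g) U
    T = mul ds (par b) (mul ds (par c) g) U
    lo-xy⋆lo-z : mul ds (mul ds a c ⊞ k ⊙ mul ds (par b) e) f U ≡ P + k * Q
    lo-xy⋆lo-z = trans (mul-distribʳ-⊞ ds _ _ f U)
      (cong₂ _+_ (assoc a c f U) (trans (mul-⊙ˡ ds k _ f U) (cong (k *_) (assoc (par b) e f U))))
    par-hi-xy⋆hi-z : mul ds (par (mul ds (par a) e ⊞ mul ds b c)) g U ≡ R + T
    par-hi-xy⋆hi-z = begin
      mul ds (par (mul ds (par a) e ⊞ mul ds b c)) g U
        ≡⟨ trans (mul-congʳ ds g (par-distrib-⊞ _ _) U) (mul-distribʳ-⊞ ds _ _ g U) ⟩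
      mul ds (par (mul ds (par a) e)) g U + mul ds (par (mul ds b c)) g U
        ≡⟨ cong₂ _+_ (mul-congʳ ds g (par-mul-par ds a e) U) (mul-congʳ ds g (par-mul ds b c) U) ⟩
      mul ds (mul ds a (par e)) g U + mul ds (mul ds (par b) (par c)) g U
        ≡⟨ cong₂ _+_ (assoc a (par e) g U) (assoc (par b) (par c) g U) ⟩
      R + T ∎

  hi-assoc : mul (d ∷ ds) (mul (d ∷ ds) x y) z (true ∷ U) ≡ mul (d ∷ ds) x (mul (d ∷ ds) y z) (true ∷ U)
  hi-assoc = begin
    mul ds (par (mul ds a c ⊞ k ⊙ mul ds (par b) e)) g U + mul ds (mul ds (par a) e ⊞ mul ds b c) f U
      ≡⟨ cong₂ _+_ par-lo-xy⋆hi-z hi-xy⋆lo-z ⟩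
    (P + k * Q) + (R + T)
      ≡⟨ solve 5 (λ p q r t k → (p :+ k :* q) :+ (r :+ t) := (p :+ r) :+ (t :+ k :* q)) refl P Q R T k ⟩
    (P + R) + (T + k * Q)
      ≡⟨ cong₂ _+_ (mul-distribˡ-⊞ ds (par a) _ _ U)
                   (trans (mul-distribˡ-⊞ ds b _ _ U) (cong (_+_ T) (mul-⊙ʳ ds k b _ U))) ⟨
    mul ds (par a) (mul ds (par c) g ⊞ mul ds e f) U + mul ds b (mul ds c f ⊞ k ⊙ mul ds (par e) g) U ∎
    where
    P Q R T : ℚ
    P = mul ds (par a) (mul ds (par c) g) U
    Q = mul ds b (mul ds (par e) g) U
    R = mul ds (par a) (mul ds e f) U
    T = mul ds b (mul ds c f) U
    par-lo-xy⋆hi-z : mul ds (par (mul ds a c ⊞ k ⊙ mul ds (par b) e)) g U ≡ P + k * Q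
    par-lo-xy⋆hi-z = begin
      mul ds (par (mul ds a c ⊞ k ⊙ mul ds (par b) e)) g U
        ≡⟨ mul-congʳ ds g (λ S → trans (par-distrib-⊞ (mul ds a c) (k ⊙ mul ds (par b) e) S)
                                      (cong (_+_ (par (mul ds a c) S)) (par-⊙ k (mul ds (par b) e) S))) U ⟩
      mul ds (par (mul ds a c) ⊞ k ⊙ par (mul ds (par b) e)) g U
        ≡⟨ trans (mul-distribʳ-⊞ ds _ _ g U) (cong (_+_ (mul ds (par (mul ds a c)) g U)) (mul-⊙ˡ ds k _ g U)) ⟩
      mul ds (par (mul ds a c)) g U + k * mul ds (par (mul ds (par b) e)) g U
        ≡⟨ cong₂ (λ u v → u + k * v) (mul-congʳ ds g (par-mul ds a c) U) (mul-congʳ ds g (par-mul-par ds b e) U) ⟩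
      mul ds (mul ds (par a) (par c)) g U + k * mul ds (mul ds b (par e)) g U
        ≡⟨ cong₂ (λ u v → u + k * v) (assoc (par a) (par c) g U) (assoc b (par e) g U) ⟩
      P + k * Q ∎
    hi-xy⋆lo-z : mul ds (mul ds (par a) e ⊞ mul ds b c) f U ≡ R + T
    hi-xy⋆lo-z = trans (mul-distribʳ-⊞ ds _ _ f U) (cong₂ _+_ (assoc (par a) e f U) (assoc b c f U))

mul-assoc : ∀ {n} (ds : Vec ℕ n) (x y z : Alg n) → mul ds (mul ds x y) z ≈ mul ds x (mul ds y z)
mul-assoc [] x y z [] = ℚP.*-assoc (x []) (y []) (z [])
mul-assoc (d ∷ ds) x y z (false ∷ U) = MulAssocStep.lo-assoc d ds (mul-assoc ds) x y z U
mul-assoc (d ∷ ds) x y z (true ∷ U) = MulAssocStep.hi-assoc d ds (mul-assoc ds) x y z U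

lo-scalar : ∀ {n} (d : ℕ) (ds : Vec ℕ n) q S → Clifford.scalar (d ∷ ds) q (false ∷ S) ≡ Clifford.scalar ds q S
lo-scalar d ds q S with size S
... | zero = refl
... | suc _ = refl

par-scalar : ∀ {n} (ds : Vec ℕ n) q → par (Clifford.scalar ds q) ≈ Clifford.scalar ds q
par-scalar ds q S with size S
... | zero = ℚP.*-identityˡ q
... | suc m = ℚP.*-zeroʳ (sgn (suc m))

mul-zeroʳ : ∀ {n} (ds : Vec ℕ n) (x : Alg n) {z : Alg n} → z ≈ 0ᴬ → mul ds x z ≈ 0ᴬ
mul-zeroʳ ds x {z} e U = begin
  mul ds x z U ≡⟨ mul-congˡ ds x (λ S → trans (e S) (sym (ℚP.*-zeroˡ 0ℚ))) U ⟩
  mul ds x (0ℚ ⊙ 0ᴬ) U ≡⟨ mul-⊙ʳ ds 0ℚ x 0ᴬ U ⟩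
  0ℚ * mul ds x 0ᴬ U ≡⟨ ℚP.*-zeroˡ (mul ds x 0ᴬ U) ⟩
  0ℚ ∎

mul-zeroˡ : ∀ {n} (ds : Vec ℕ n) {z : Alg n} (x : Alg n) → z ≈ 0ᴬ → mul ds z x ≈ 0ᴬ
mul-zeroˡ ds {z} x e U = begin
  mul ds z x U ≡⟨ mul-congʳ ds x (λ S → trans (e S) (sym (ℚP.*-zeroˡ 0ℚ))) U ⟩
  mul ds (0ℚ ⊙ 0ᴬ) x U ≡⟨ mul-⊙ˡ ds 0ℚ 0ᴬ x U ⟩
  0ℚ * mul ds 0ᴬ x U ≡⟨ ℚP.*-zeroˡ (mul ds 0ᴬ x U) ⟩
  0ℚ ∎

mul-scalarʳ : ∀ {n} (ds : Vec ℕ n) (x : Alg n) q → mul ds x (Clifford.scalar ds q) ≈ (q ⊙ x)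
mul-scalarʳ [] x q [] = ℚP.*-comm (x []) q
mul-scalarʳ {suc n} (d ∷ ds) x q (false ∷ U) = begin
  mul ds (lo x) (lo sc) U + - ℕtoℚ d * mul ds (par (hi x)) (hi sc) U
    ≡⟨ cong₂ (λ a b → a + - ℕtoℚ d * b) (trans (mul-congˡ ds (lo x) (lo-scalar d ds q) U) (mul-scalarʳ ds (lo x) q U))
         (mul-zeroʳ ds (par (hi x)) (λ S → refl) U) ⟩
  q * x (false ∷ U) + - ℕtoℚ d * 0ℚ
    ≡⟨ solve 3 (λ q a k → q :* a :+ k :* con 0ℚ := q :* a) refl q (x (false ∷ U)) (- ℕtoℚ d) ⟩
  q * x (false ∷ U) ∎
  where
  sc : Alg (suc n)
  sc = Clifford.scalar (d ∷ ds) q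
mul-scalarʳ {suc n} (d ∷ ds) x q (true ∷ U) = begin
  mul ds (par (lo x)) (hi sc) U + mul ds (hi x) (lo sc) U
    ≡⟨ cong₂ _+_ (mul-zeroʳ ds (par (lo x)) (λ S → refl) U)
         (trans (mul-congˡ ds (hi x) (lo-scalar d ds q) U) (mul-scalarʳ ds (hi x) q U)) ⟩
  0ℚ + q * x (true ∷ U)
    ≡⟨ ℚP.+-identityˡ _ ⟩
  q * x (true ∷ U) ∎
  where
  sc : Alg (suc n)
  sc = Clifford.scalar (d ∷ ds) q

mul-scalarˡ : ∀ {n} (ds : Vec ℕ n) (x : Alg n) q → mul ds (Clifford.scalar ds q) x ≈ (q ⊙ x)
mul-scalarˡ [] x q [] = refl
mul-scalarˡ {suc n} (d ∷ ds) x q (false ∷ U) = begin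
  mul ds (lo sc) (lo x) U + - ℕtoℚ d * mul ds (par (hi sc)) (hi x) U
    ≡⟨ cong₂ (λ a b → a + - ℕtoℚ d * b) (trans (mul-congʳ ds (lo x) (lo-scalar d ds q) U) (mul-scalarˡ ds (lo x) q U))
         (mul-zeroˡ ds (hi x) (λ S → ℚP.*-zeroʳ (sgn (size S))) U) ⟩
  q * x (false ∷ U) + - ℕtoℚ d * 0ℚ
    ≡⟨ solve 3 (λ q a k → q :* a :+ k :* con 0ℚ := q :* a) refl q (x (false ∷ U)) (- ℕtoℚ d) ⟩
  q * x (false ∷ U) ∎
  where
  sc : Alg (suc n)
  sc = Clifford.scalar (d ∷ ds) q
mul-scalarˡ {suc n} (d ∷ ds) x q (true ∷ U) = begin
  mul ds (par (lo sc)) (hi x) U + mul ds (hi sc) (lo x) U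
    ≡⟨ cong₂ _+_ (trans (mul-congʳ ds (hi x) (λ S → trans (par-cong (lo-scalar d ds q) S) (par-scalar ds q S)) U)
                        (mul-scalarˡ ds (hi x) q U))
         (mul-zeroˡ ds (lo x) (λ S → refl) U) ⟩
  q * x (true ∷ U) + 0ℚ
    ≡⟨ ℚP.+-identityʳ _ ⟩
  q * x (true ∷ U) ∎
  where
  sc : Alg (suc n)
  sc = Clifford.scalar (d ∷ ds) q

emptyBasis : ∀ n → Basis n
emptyBasis zero = []
emptyBasis (suc n) = false ∷ emptyBasis n

⊕-identityʳ : ∀ {n} (S : Basis n) → S ⊕ emptyBasis n ≡ S
⊕-identityʳ [] = refl
⊕-identityʳ (false ∷ S) = cong (false ∷_) (⊕-identityʳ S)
⊕-identityʳ (true ∷ S) = cong (true ∷_) (⊕-identityʳ S)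

scalar-emptyBasis : ∀ {n} (ds : Vec ℕ n) q → Clifford.scalar ds q (emptyBasis n) ≡ q
scalar-emptyBasis [] q = refl
scalar-emptyBasis (d ∷ ds) q = trans (lo-scalar d ds q (emptyBasis _)) (scalar-emptyBasis ds q)

basisNorm : ∀ {n} → Vec ℕ n → Basis n → ℕ
basisNorm [] [] = 1
basisNorm (d ∷ ds) (false ∷ S) = basisNorm ds S
basisNorm (d ∷ ds) (true ∷ S) = d ℕ.* basisNorm ds S

basisNorm-nonZero : ∀ {n} {ds : Vec ℕ n} → All (0 <_) ds → ∀ S → ℕ.NonZero (basisNorm ds S)
basisNorm-nonZero VAll.[] [] = _
basisNorm-nonZero (_ VAll.∷ ps) (false ∷ S) = basisNorm-nonZero ps S
basisNorm-nonZero {ds = d ∷ ds} (p VAll.∷ ps) (true ∷ S) =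
  ℕP.m*n≢0 d (basisNorm ds S) {{ℕ.>-nonZero p}} {{basisNorm-nonZero ps S}}

conjSign : ∀ {n} → Vec ℕ n → Basis n → ℚ
conjSign ds S = Clifford.revSign ds (size S) * sgn (size S)

conjSign-isSign : ∀ {n} (ds : Vec ℕ n) S → IsSign (conjSign ds S)
conjSign-isSign ds S = sign-* (revSign-isSign (size S)) (sgn-isSign (size S))
  where
  revSign-isSign : ∀ k → IsSign (Clifford.revSign ds k)
  revSign-isSign zero = inj₁ refl
  revSign-isSign (suc k) = sign-* (sgn-isSign k) (revSign-isSign k)

-- That is, e_S ē_S = ∏_{j ∈ S} d_j.
mulCoef-diagonal : ∀ {n} (ds : Vec ℕ n) S → mulCoef ds S S * conjSign ds S ≡ ℕtoℚ (basisNorm ds S)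
mulCoef-diagonal [] [] = refl
mulCoef-diagonal (d ∷ ds) (false ∷ S) =
  trans (solve 2 (λ c e → con 1ℚ :* con 1ℚ :* c :* e := c :* e) refl (mulCoef ds S S) (conjSign ds S))
        (mulCoef-diagonal ds S)
mulCoef-diagonal (d ∷ ds) (true ∷ S) = begin
  sgn k * - ℕtoℚ d * c * (sgn k * r * - sgn k)
    ≡⟨ solve 4 (λ s D c r → s :* (:- D) :* c :* (s :* r :* (:- s)) := D :* (c :* (r :* s)) :* (s :* s)) refl
         (sgn k) (ℕtoℚ d) c r ⟩
  ℕtoℚ d * (c * (r * sgn k)) * (sgn k * sgn k)
    ≡⟨ cong₂ (λ a b → ℕtoℚ d * a * b) (mulCoef-diagonal ds S) (sgn-square k) ⟩
  ℕtoℚ d * ℕtoℚ (basisNorm ds S) * 1ℚ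
    ≡⟨ trans (ℚP.*-identityʳ _) (sym (ℕtoℚ-* d (basisNorm ds S))) ⟩
  ℕtoℚ (d ℕ.* basisNorm ds S) ∎
  where
  k : ℕ
  k = size S
  c r : ℚ
  c = mulCoef ds S S
  r = Clifford.revSign ds k

module _ {n : ℕ} (ds : Vec ℕ n) where
  open Clifford ds

  ≡conjSign*conj : ∀ x S → x S ≡ conjSign ds S * conj x S
  ≡conjSign*conj x S = begin
    x S                          ≡⟨ ℚP.*-identityˡ (x S) ⟨
    1ℚ * x S                     ≡⟨ cong (_* x S) (sign-square (conjSign-isSign ds S)) ⟨
    ε * ε * x S                  ≡⟨ solve 3 (λ r s a → r :* s :* (r :* s) :* a := r :* s :* (r :* (s :* a))) refl
                                      (revSign (size S)) (sgn (size S)) (x S) ⟩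
    ε * conj x S                 ∎
    where
    ε : ℚ
    ε = conjSign ds S

  *A-constantCoeff : ∀ x y → (x *A y) (emptyBasis n) ≡ sumList (map (λ S → x S * y S * mulCoef ds S S) (allBasis n))
  *A-constantCoeff x y =
    cong sumList (LP.map-cong (λ S → cong (λ T → x S * y T * mulCoef ds S T) (⊕-identityʳ S)) (allBasis n))

  conj≡scalar*inverse : ∀ {x y q} → (y *A x) ≈ oneA → (x *A conj x) ≈ scalar q → ∀ S → conj x S ≡ q * y S
  conj≡scalar*inverse {x} {y} {q} yx≈1 xx̄≈q S = begin
    x̄ S                           ≡⟨ ℚP.*-identityˡ (x̄ S) ⟨
    1ℚ * x̄ S                      ≡⟨ mul-scalarˡ ds x̄ 1ℚ S ⟨
    mul ds oneA x̄ S               ≡⟨ mul-congʳ ds x̄ (λ U → trans (sym (*A≈mul ds y x U)) (yx≈1 U)) S ⟨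
    mul ds (mul ds y x) x̄ S       ≡⟨ mul-assoc ds y x x̄ S ⟩
    mul ds y (mul ds x x̄) S       ≡⟨ mul-congˡ ds y (λ U → trans (sym (*A≈mul ds x x̄ U)) (xx̄≈q U)) S ⟩
    mul ds y (scalar q) S         ≡⟨ mul-scalarʳ ds y q S ⟩
    q * y S                       ∎
    where
    x̄ : Alg n
    x̄ = conj x

-- Coefficients of a Clifford unit
module UnitCoefficients {n : ℕ} (ds : Vec ℕ n) (ds-positive : All (0 <_) ds)
  (N : ℕ) .{{_ : ℕ.NonZero N}} (x y : Alg n) (q : ℚ)
  (xy≈1 : Clifford._*A_ ds x y ≈ Clifford.oneA ds)
  (conj≡q*y : ∀ S → Clifford.conj ds x S ≡ q * y S)
  (Ny-integral : ∀ S → Integral (y S * ℕtoℚ N)) where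

  open Clifford ds

  k : Basis n → ℤ
  k T = proj₁ (Ny-integral T)

  y*N≡k : ∀ T → y T * ℕtoℚ N ≡ ℤtoℚ (k T)
  y*N≡k T = proj₂ (Ny-integral T)

  normTerm : Basis n → ℕ
  normTerm T = ℤ.∣ k T ∣ ℕ.* ℤ.∣ k T ∣ ℕ.* basisNorm ds T

  normSum : ℕ
  normSum = ℕL.sum (map normTerm (allBasis n))

  x≡conjSign*q*y : ∀ S → x S ≡ conjSign ds S * (q * y S)
  x≡conjSign*q*y S = trans (≡conjSign*conj ds x S) (cong (conjSign ds S *_) (conj≡q*y S))

  N²*diagonalTerm : ∀ T → ℕtoℚ N * ℕtoℚ N * (x T * y T * mulCoef ds T T) ≡ q * ℕtoℚ (normTerm T)
  N²*diagonalTerm T = begin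
    ν * ν * (x T * y T * c)
      ≡⟨ cong (λ t → ν * ν * (t * y T * c)) (x≡conjSign*q*y T) ⟩
    ν * ν * (ε * (q * y T) * y T * c)
      ≡⟨ solve 5 (λ N e q y c → N :* N :* (e :* (q :* y) :* y :* c) := q :* ((y :* N) :* (y :* N) :* (c :* e))) refl
           ν ε q (y T) c ⟩
    q * ((y T * ν) * (y T * ν) * (c * ε))
      ≡⟨ cong₂ (λ a b → q * (a * a * b)) (y*N≡k T) (mulCoef-diagonal ds T) ⟩
    q * (ℤtoℚ (k T) * ℤtoℚ (k T) * ℕtoℚ (basisNorm ds T))
      ≡⟨ cong (λ a → q * (a * ℕtoℚ (basisNorm ds T))) (ℤtoℚ-square (k T)) ⟩
    q * (ℕtoℚ (ℤ.∣ k T ∣ ℕ.* ℤ.∣ k T ∣) * ℕtoℚ (basisNorm ds T))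
      ≡⟨ cong (q *_) (ℕtoℚ-* (ℤ.∣ k T ∣ ℕ.* ℤ.∣ k T ∣) (basisNorm ds T)) ⟨
    q * ℕtoℚ (normTerm T) ∎
    where
    ν ε c : ℚ
    ν = ℕtoℚ N
    ε = conjSign ds T
    c = mulCoef ds T T

  N*N≡q*normSum : ℕtoℚ (N ℕ.* N) ≡ q * ℕtoℚ normSum
  N*N≡q*normSum = begin
    ℕtoℚ (N ℕ.* N)                                        ≡⟨ ℕtoℚ-* N N ⟩
    ν * ν                                                 ≡⟨ ℚP.*-identityʳ (ν * ν) ⟨
    ν * ν * 1ℚ                                            ≡⟨ cong (ν * ν *_) one≡diagonalSum ⟩
    ν * ν * sumList (map diagonalTerm B)                  ≡⟨ sumList-*ˡ (ν * ν) diagonalTerm B ⟨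
    sumList (map (λ T → ν * ν * diagonalTerm T) B)        ≡⟨ cong sumList (LP.map-cong N²*diagonalTerm B) ⟩
    sumList (map (λ T → q * ℕtoℚ (normTerm T)) B)         ≡⟨ sumList-*ˡ q (ℕtoℚ ∘ normTerm) B ⟩
    q * sumList (map (ℕtoℚ ∘ normTerm) B)                 ≡⟨ cong (q *_) (ℕtoℚ-sum normTerm B) ⟨
    q * ℕtoℚ normSum                                      ∎
    where
    ν : ℚ
    ν = ℕtoℚ N
    B : List (Basis n)
    B = allBasis n
    diagonalTerm : Basis n → ℚ
    diagonalTerm T = x T * y T * mulCoef ds T T
    one≡diagonalSum : 1ℚ ≡ sumList (map diagonalTerm B)
    one≡diagonalSum = trans (sym (trans (xy≈1 (emptyBasis n)) (scalar-emptyBasis ds 1ℚ))) (*A-constantCoeff ds x y)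

  instance
    normSum-nonZero : ℕ.NonZero normSum
    normSum-nonZero = ℕ.≢-nonZero λ normSum≡0 →
      ℕ.≢-nonZero⁻¹ (N ℕ.* N) {{ℕP.m*n≢0 N N}}
        (ℕtoℚ-injective (trans N*N≡q*normSum (trans (cong (λ K → q * ℕtoℚ K) normSum≡0) (ℚP.*-zeroʳ q))))

  ∣m∣*normSum≡∣k∣*N*N : ∀ S m → x S * ℕtoℚ N ≡ ℤtoℚ m → ℤ.∣ m ∣ ℕ.* normSum ≡ ℤ.∣ k S ∣ ℕ.* (N ℕ.* N)
  ∣m∣*normSum≡∣k∣*N*N S m x*N≡m = begin
    ℤ.∣ m ∣ ℕ.* normSum                   ≡⟨ ℤP.abs-* m (+ normSum) ⟨
    ℤ.∣ m ℤ.* + normSum ∣                 ≡⟨ ℤtoℚ-sign⇒∣≡∣ (m ℤ.* + normSum) (k S ℤ.* + (N ℕ.* N))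
                                               (conjSign-isSign ds S) m*K≡±k*N² ⟩
    ℤ.∣ k S ℤ.* + (N ℕ.* N) ∣             ≡⟨ ℤP.abs-* (k S) (+ (N ℕ.* N)) ⟩
    ℤ.∣ k S ∣ ℕ.* (N ℕ.* N)               ∎
    where
    ε K : ℚ
    ε = conjSign ds S
    K = ℕtoℚ normSum
    m*K≡±k*N² : ℤtoℚ (m ℤ.* + normSum) ≡ ε * ℤtoℚ (k S ℤ.* + (N ℕ.* N))
    m*K≡±k*N² = begin
      ℤtoℚ (m ℤ.* + normSum)                    ≡⟨ ℤtoℚ-* m (+ normSum) ⟩
      ℤtoℚ m * K                                ≡⟨ cong (_* K) x*N≡m ⟨
      x S * ℕtoℚ N * K                          ≡⟨ cong (λ t → t * ℕtoℚ N * K) (x≡conjSign*q*y S) ⟩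
      ε * (q * y S) * ℕtoℚ N * K                ≡⟨ solve 5 (λ e q y N K → e :* (q :* y) :* N :* K := e :* ((y :* N) :* (q :* K))) refl
                                                     ε q (y S) (ℕtoℚ N) K ⟩
      ε * ((y S * ℕtoℚ N) * (q * K))            ≡⟨ cong₂ (λ a b → ε * (a * b)) (y*N≡k S) (sym N*N≡q*normSum) ⟩
      ε * (ℤtoℚ (k S) * ℕtoℚ (N ℕ.* N))         ≡⟨ cong (ε *_) (ℤtoℚ-* (k S) (+ (N ℕ.* N))) ⟨
      ε * ℤtoℚ (k S ℤ.* + (N ℕ.* N))            ∎

  coefficient-bound : ∀ S m → x S * ℕtoℚ N ≡ ℤtoℚ m → ℤ.∣ m ∣ ≤ N ℕ.* N
  coefficient-bound S m x*N≡m = ℕP.*-cancelʳ-≤ ℤ.∣ m ∣ (N ℕ.* N) normSum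
    (ℕP.≤-trans (ℕP.≤-reflexive (∣m∣*normSum≡∣k∣*N*N S m x*N≡m))
      (ℕP.≤-trans (ℕP.*-monoˡ-≤ (N ℕ.* N) ∣k∣≤normSum) (ℕP.≤-reflexive (ℕP.*-comm normSum (N ℕ.* N)))))
    where
    ∣k∣≤normSum : ℤ.∣ k S ∣ ≤ normSum
    ∣k∣≤normSum = ℕP.≤-trans (m≤m*m*n ℤ.∣ k S ∣ (basisNorm ds S) {{basisNorm-nonZero ds-positive S}})
                             (∈⇒≤sum (∈-map⁺ normTerm (∈-allBasis S)))

-- Denominators of an order
commonDenominator : List ℚ → ℕ
commonDenominator qs = ℕL.product (map ℚ.↧ₙ_ qs)

commonDenominator-nonZero : ∀ qs → ℕ.NonZero (commonDenominator qs)
commonDenominator-nonZero qs = ℕLP.product≢0 (LAllP.map⁺ (LAll.universal (λ _ → _) qs))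

commonDenominator-integral : ∀ {q qs} → q ∈ qs → Integral (q * ℕtoℚ (commonDenominator qs))
commonDenominator-integral {q} q∈qs =
  *-multiple-integral {q} (*-denominator-integral q) (ℕLP.∈⇒∣product (∈-map⁺ ℚ.↧ₙ_ q∈qs))

coefficients : ∀ {n} → List (Alg n) → List ℚ
coefficients {n} = L.concatMap (λ g → map g (allBasis n))

∈-coefficients : ∀ {n} {g : Alg n} {gs} → g ∈ gs → ∀ S → g S ∈ coefficients gs
∈-coefficients {n} g∈gs S = ∈-concatMap⁺ (λ g → map g (allBasis n)) (Any.map (λ { refl → ∈-map⁺ _ (∈-allBasis S) }) g∈gs)

module _ {n : ℕ} (ds : Vec ℕ n) where
  open Clifford ds

  zComb-integral : ∀ N {gs} → LAll (λ g → ∀ S → Integral (g S * ℕtoℚ N)) gs →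
    ∀ cs S → Integral (zComb (L.zip cs gs) S * ℕtoℚ N)
  zComb-integral N _ [] S = integral-resp (sym (ℚP.*-zeroˡ (ℕtoℚ N))) (integral-ℤtoℚ (+ 0))
  zComb-integral N LAll.[] (_ ∷ _) S = integral-resp (sym (ℚP.*-zeroˡ (ℕtoℚ N))) (integral-ℤtoℚ (+ 0))
  zComb-integral N {g ∷ gs} (g-integral LAll.∷ gs-integral) (c ∷ cs) S = integral-resp
    (sym (ℚP.*-distribʳ-+ (ℕtoℚ N) (ℤtoℚ c * g S) _))
    (integral-+ (integral-resp (sym (ℚP.*-assoc (ℤtoℚ c) (g S) (ℕtoℚ N))) (integral-* (integral-ℤtoℚ c) (g-integral S)))
                (zComb-integral N gs-integral cs S))

  order-denominator : ∀ {O} → IsOrder O →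
    Σ ℕ λ N → ℕ.NonZero N × (∀ {x} → O x → ∀ S → Integral (x S * ℕtoℚ N))
  order-denominator {O} ord = N , commonDenominator-nonZero (coefficients gens) , O-integral
    where
    open IsOrder ord
    N : ℕ
    N = commonDenominator (coefficients gens)
    O-integral : ∀ {x} → O x → ∀ S → Integral (x S * ℕtoℚ N)
    O-integral Ox S with generated Ox
    ... | cs , _ , x≈zComb = integral-resp (cong (_* ℕtoℚ N) (sym (x≈zComb S)))
      (zComb-integral N (LAll.tabulate (λ g∈gens S → commonDenominator-integral (∈-coefficients g∈gens S))) cs S)

-- Enumerating candidate units
integersUpTo : ℕ → List ℤ
integersUpTo B = map (λ i → + i) (L.upTo (suc B)) ++ map (λ i → ℤ.- (+ i)) (L.upTo (suc B))

∈-integersUpTo : ∀ {B} m → ℤ.∣ m ∣ ≤ B → m ∈ integersUpTo B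
∈-integersUpTo (+ a) a≤B = ∈-++⁺ˡ (∈-map⁺ (λ i → + i) (∈-upTo⁺ (ℕ.s≤s a≤B)))
∈-integersUpTo {B} -[1+ a ] a<B =
  ∈-++⁺ʳ (map (λ i → + i) (L.upTo (suc B))) (∈-map⁺ (λ i → ℤ.- (+ i)) (∈-upTo⁺ (ℕ.s≤s a<B)))

boundedFractions : ∀ N .{{_ : ℕ.NonZero N}} → List ℚ
boundedFractions N = map (λ m → ℤtoℚ m * ℚ.1/ ℕtoℚ N) (integersUpTo (N ℕ.* N))
  where
  instance
    N≢0 : ℚ.NonZero (ℕtoℚ N)
    N≢0 = ℕtoℚ-nonZero N

join : ∀ {n} → Alg n → Alg n → Alg (suc n)
join a b (false ∷ S) = a S
join a b (true ∷ S) = b S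

elementsWithCoefficientsIn : ∀ n → List ℚ → List (Alg n)
elementsWithCoefficientsIn zero V = map (λ v _ → v) V
elementsWithCoefficientsIn (suc n) V = L.cartesianProductWith join (elementsWithCoefficientsIn n V) (elementsWithCoefficientsIn n V)

∈-elementsWithCoefficientsIn : ∀ {n} V (x : Alg n) → (∀ S → x S ∈ V) → Any (x ≈_) (elementsWithCoefficientsIn n V)
∈-elementsWithCoefficientsIn {zero} V x x∈V = AnyP.map⁺ (Any.map (λ { x[]≡v [] → x[]≡v }) (x∈V []))
∈-elementsWithCoefficientsIn {suc n} V x x∈V = AnyP.cartesianProductWith⁺ join glue
  (∈-elementsWithCoefficientsIn V (lo x) (x∈V ∘ (false ∷_)))
  (∈-elementsWithCoefficientsIn V (hi x) (x∈V ∘ (true ∷_)))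
  where
  glue : ∀ {a b} → lo x ≈ a → hi x ≈ b → x ≈ join a b
  glue lo≈a hi≈b (false ∷ S) = lo≈a S
  glue lo≈a hi≈b (true ∷ S) = hi≈b S

module _ {n : ℕ} (ds : Vec ℕ n) (ds-positive : All (0 <_) ds) where
  open Clifford ds

  cliffordUnit-coefficient∈boundedFractions : ∀ {O} N .{{_ : ℕ.NonZero N}} →
    (∀ {x} → O x → ∀ S → Integral (x S * ℕtoℚ N)) →
    ∀ {x} → IsCliffordUnit O x → ∀ S → x S ∈ boundedFractions N
  cliffordUnit-coefficient∈boundedFractions N O-integral {x} (Ox , (y , Oy , xy≈1 , yx≈1) , _ , (q , xx̄≈q) , _) S =
    subst (_∈ boundedFractions N) (sym x≡m/N) (∈-map⁺ _ (∈-integersUpTo m ∣m∣≤N*N))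
    where
    instance
      N≢0 : ℚ.NonZero (ℕtoℚ N)
      N≢0 = ℕtoℚ-nonZero N
    m : ℤ
    m = proj₁ (O-integral Ox S)
    x≡m/N : x S ≡ ℤtoℚ m * ℚ.1/ ℕtoℚ N
    x≡m/N = *≡⇒≡*1/ (x S) (ℕtoℚ N) (ℤtoℚ m) (proj₂ (O-integral Ox S))
    ∣m∣≤N*N : ℤ.∣ m ∣ ≤ N ℕ.* N
    ∣m∣≤N*N = UnitCoefficients.coefficient-bound ds ds-positive N x y q xy≈1
      (conj≡scalar*inverse ds yx≈1 xx̄≈q) (O-integral Oy) S m (proj₂ (O-integral Ox S))

mainTheorem16 : (n : ℕ) (d : Vec ℕ n) → All (0 <_) d →
    (O : Alg n → Set) → Clifford.IsOrder d O →
    Clifford.IsFinite d (Clifford.IsCliffordUnit d O)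
mainTheorem16 n d d-positive O isOrder with order-denominator d isOrder
... | N , N≢0 , O-integral =
  elementsWithCoefficientsIn n (boundedFractions N {{N≢0}}) ,
  λ x x-unit → ∈-elementsWithCoefficientsIn _ x
    (cliffordUnit-coefficient∈boundedFractions d d-positive N {{N≢0}} O-integral x-unit)
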